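{- Let $A$ be a formula with $c(A)=n$ and let $T_A$ be the $\mathbf{RWBL}$ reduction of $A$. Then every leaf $u$ of $T_A$ has depth $d(u)\le n$, and the height of $T_A$ satisfies $h(T_A)\le n$.
   Context: Formulas are built from the constant $\bot$ and propositional variables $p_0,p_1,\dots$ by the binary connectives $\odot,\rightarrow$. $c(A)$ is the number of connective occurrences in $A$. The symbol $\top$ stands for $\bot\rightarrow\bot$ and is treated as an atomic constant. Atomic formulas are the variables, $\bot$ and $\top$. $A<_cB$ means $c(A)<c(B)$, or $c(A)=c(B)$ and $A$ precedes $B$ in a fixed lexicographic order. A relational sequent is $\Gamma\triangleleft\Delta$, with $\Gamma,\Delta$ finite multisets of formulas and $\triangleleft\in\{\ll\}\cup\{\preccurlyeq_z,\prec_z:z\in\mathbb Z\}$; if $\triangleleft$ is $\ll$ then $|\Gamma|,|\Delta|\le1$. We write $\preccurlyeq,\prec$ for index $0$. A relational hypersequent is a finite set of relational sequents, written $S_1|\dots|S_k$, where $|$ also denotes union. It is irreducible if all its formulas are atomic. Abbreviations (each a hypersequent): - $\overline{A\ll B}=A\preccurlyeq B|B\preccurlyeq A|B\ll A$; - $\overline{A\le B}=B\prec A|B\ll A$; - $\overline{A\preccurlyeq B}=A\ll B|B\prec A|B\ll A$; - $\overline{A\prec B}=A\ll B|B\preccurlyeq A|B\ll A$; - $\overline{A\sim B}=A\ll B|B\ll A$; - $\overline{\preccurlyeq_1A,B}=\overline{A\sim B}|\overline{A\ll\top}|\overline{B\ll\top}|A,B\prec_{ -1}$; - $\overline{A,B\prec_{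 -1}}=\overline{A\sim B}|\overline{A\ll\top}|\overline{B\ll\top}|\preccurlyeq_1A,B$. Antecedents: - $I_{\odot_1}=\overline{A\ll B}$, $I_{\odot_2}=\overline{B\ll A}$, $I_{\odot_3}=\overline{\preccurlyeq_1A,B}$, $I_{\odot_4}=\overline{A,B\prec_{ -1}}$, $I_{\odot_5}=\overline{\top\preccurlyeq A}|\overline{\top\preccurlyeq B}$; - $I_{\rightarrow_1}=\overline{B\ll A}$, $I_{\rightarrow_2}=\overline{B\prec A}$, $I_{\rightarrow_3}=\overline{A\le B}$. Rewriting rules. Let $G$ be a relational hypersequent whose most complex formula w.r.t. $<_c$ is the pivot $A\circ B$. Let: - $H$ be the set of sequents of $G$ not containing $A\circ B$; - $G'$ be the set of $\ll$-sequents containing it; - $G''$ be the set of $\preccurlyeq_z/\prec_z$-sequents containing it; - $G'''\subseteq G''$ be those with relation $\preccurlyeq$ (index $0$) and at most one formula per side. Let $C=A$ if $A<_cB$, else $C=B$. Substitutions act on each sequent: - $X(D\Leftarrow E)$ replaces every occurrence of $D$ by $E$; - $X(D\Leftarrow E,E')$ replaces every occurrence of $D$ by $E,E'$; - for $l$ left and $r$ right occurrences of $A\odot B$, $(A\odot B\Leftarrow A,B\triangleleft_{+l-r}A,B)$ deletes them, adds one copy of $A,B$ on each side, and changes index $z$ to $z+l-r$; - for $l$ left and $r$ right occurrences of $A\rightarrow B$, $(A\rightarrow B\Leftarrow A^r,B^l\triangleleft A^l,B^r)$ deletes them, adds $r$ copies of $A$ and $l$ of $B$ on the left, and $l$ of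 $A$ and $r$ of $B$ on the right. Premises of $(\odot)$, in order, are $I_{\odot_i}|G_{\odot_i}$ with: - $G_{\odot_1}=G(A\odot B\Leftarrow A)|H$; - $G_{\odot_2}=G(A\odot B\Leftarrow B)|H$; - $G_{\odot_3}=G'(A\odot B\Leftarrow C)|G''(A\odot B\Leftarrow A,B)|H$; - $G_{\odot_4}=G'(A\odot B\Leftarrow C)|G''(A\odot B\Leftarrow A,B\triangleleft_{+l-r}A,B)|H$; - $G_{\odot_5}=G'(A\odot B\Leftarrow\top)|G'''(A\odot B\Leftarrow\top)|H$. Premises of $(\rightarrow)$ are $I_{\rightarrow_i}|G_{\rightarrow_i}$ with: - $G_{\rightarrow_1}=G(A\rightarrow B\Leftarrow B)|H$; - $G_{\rightarrow_2}=G'(A\rightarrow B\Leftarrow C)|G''(A\rightarrow B\Leftarrow A^r,B^l\triangleleft A^l,B^r)|H$; - $G_{\rightarrow_3}=G'(A\rightarrow B\Leftarrow\top)|G'''(A\rightarrow B\Leftarrow\top)|H$. The $\mathbf{RWBL}$ reduction $T_A$ of a formula $A$ is the labeled rooted ordered tree defined as follows. The root is labeled $\top\preccurlyeq A$. A node with irreducible label is a leaf. A node with reducible label $G$ has as children, in order, nodes labeled by the premises of the rewriting rule whose conclusion is $G$ and whose pivot is the most complex formula of $G$. The depth $d(u)$ of a node is the length of the path from the root to it; the height $h(T_A)$ is the number of edges on a longest root-to-leaf path. -}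

module Defs where

open import Data.Nat using (ℕ; zero; suc; _+_; _≤_; _<ᵇ_; _≡ᵇ_)
open import Data.Integer as ℤ using (ℤ; +_; -[1+_])
open import Data.List using (List; []; _∷_; _++_; map; concatMap; filter; length; replicate)
open import Data.Bool using (Bool; true; false; _∧_; _∨_; not; if_then_else_; T)
open import Data.List.Membership.Propositional using (_∈_)
open import Data.Unit using (⊤)
open import Data.Empty using (⊥)
open import Data.Product using (_×_)

infixr 6 _⊙_ _⇒_
data Fm : Set where
  bot : Fm
  top : Fm
  var : ℕ → Fm
  _⊙_ : Fm → Fm → Fm
  _⇒_ : Fm → Fm → Fm

c : Fm → ℕ
c bot = 0
c top = 0
c (var _) = 0
c (A ⊙ B) = suc (c A + c B)
c (A ⇒ B) = suc (c A + c B)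

-- formulas of the original language: built from ⊥ and variables only
NoTop : Fm → Set
NoTop bot = ⊤
NoTop top = ⊥
NoTop (var _) = ⊤
NoTop (A ⊙ B) = NoTop A × NoTop B
NoTop (A ⇒ B) = NoTop A × NoTop B

atomic : Fm → Bool
atomic (_ ⊙ _) = false
atomic (_ ⇒ _) = false
atomic _ = true

data Cmp : Set where
  LT EQ GT : Cmp

cmpℕ : ℕ → ℕ → Cmp
cmpℕ m n = if m <ᵇ n then LT else (if m ≡ᵇ n then EQ else GT)

tag : Fm → ℕ
tag bot = 0
tag top = 1
tag (var _) = 2
tag (_ ⊙ _) = 3
tag (_ ⇒ _) = 4

lexThen : Cmp → Cmp → Cmp
lexThen LT _ = LT
lexThen EQ d = d
lexThen GT _ = GT

cmpFm : Fm → Fm → Cmp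
cmpFm (var i) (var j) = cmpℕ i j
cmpFm (A ⊙ B) (A' ⊙ B') = lexThen (cmpFm A A') (cmpFm B B')
cmpFm (A ⇒ B) (A' ⇒ B') = lexThen (cmpFm A A') (cmpFm B B')
cmpFm F G = cmpℕ (tag F) (tag G)

isLT : Cmp → Bool
isLT LT = true
isLT _ = false

isEQ : Cmp → Bool
isEQ EQ = true
isEQ _ = false

eqF : Fm → Fm → Bool
eqF A B = isEQ (cmpFm A B)

_<c_ : Fm → Fm → Bool
A <c B = (c A <ᵇ c B) ∨ ((c A ≡ᵇ c B) ∧ isLT (cmpFm A B))

maxFrom : Fm → List Fm → Fm
maxFrom m [] = m
maxFrom m (F ∷ Fs) = maxFrom (if m <c F then F else m) Fs

maxOf : List Fm → Fm
maxOf [] = top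
maxOf (F ∷ Fs) = maxFrom F Fs

-- Relational sequents and hypersequents
-- (multisets and sets represented by lists; order/duplicates are irrelevant)

data Rel : Set where
  ll  : Rel
  pre : ℤ → Rel
  str : ℤ → Rel

record Seq : Set where
  constructor sq
  field
    ant : List Fm
    rel : Rel
    suc′ : List Fm
open Seq public

Hyp : Set
Hyp = List Seq

fmsS : Seq → List Fm
fmsS s = ant s ++ suc′ s

fmsH : Hyp → List Fm
fmsH = concatMap fmsS

allB : List Fm → Bool
allB [] = true
allB (F ∷ Fs) = atomic F ∧ allB Fs

irreducible : Hyp → Bool
irreducible G = allB (fmsH G)

anyEq : Fm → List Fm → Bool
anyEq D [] = false
anyEq D (F ∷ Fs) = eqF D F ∨ anyEq D Fs

count : Fm → List Fm → ℕ
count D [] = 0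
count D (F ∷ Fs) = if eqF D F then suc (count D Fs) else count D Fs

removeAll : Fm → List Fm → List Fm
removeAll D = filter′ where
  filter′ : List Fm → List Fm
  filter′ [] = []
  filter′ (F ∷ Fs) = if eqF D F then filter′ Fs else F ∷ filter′ Fs

has : Fm → Seq → Bool
has D s = anyEq D (fmsS s)

isLL : Seq → Bool
isLL s with rel s
... | ll = true
... | _ = false

isPre0Small : Seq → Bool
isPre0Small (sq Γ (pre (+ 0)) Δ) = (length Γ <ᵇ 2) ∧ (length Δ <ᵇ 2)
isPre0Small _ = false

_≪_ : Fm → Fm → Seq
A ≪ B = sq (A ∷ []) ll (B ∷ [])

_≼_ : Fm → Fm → Seq
A ≼ B = sq (A ∷ []) (pre (+ 0)) (B ∷ [])

_≺_ : Fm → Fm → Seq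
A ≺ B = sq (A ∷ []) (str (+ 0)) (B ∷ [])

sub1 : Fm → Fm → Seq → Seq
sub1 D E (sq Γ r Δ) = sq (map f Γ) r (map f Δ)
  where f : Fm → Fm
        f F = if eqF D F then E else F

sub2 : Fm → Fm → Fm → Seq → Seq
sub2 D E E′ (sq Γ r Δ) = sq (concatMap f Γ) r (concatMap f Δ)
  where f : Fm → List Fm
        f F = if eqF D F then E ∷ E′ ∷ [] else F ∷ []

shiftRel : ℤ → Rel → Rel
shiftRel k ll = ll
shiftRel k (pre z) = pre (z ℤ.+ k)
shiftRel k (str z) = str (z ℤ.+ k)

subOdotShift : Fm → Fm → Seq → Seq
subOdotShift A B (sq Γ r Δ) =
  sq (removeAll D Γ ++ A ∷ B ∷ [])
     (shiftRel ((+ count D Γ) ℤ.- (+ count D Δ)) r)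
     (removeAll D Δ ++ A ∷ B ∷ [])
  where D = A ⊙ B

subImp : Fm → Fm → Seq → Seq
subImp A B (sq Γ r Δ) =
  sq (removeAll D Γ ++ replicate nr A ++ replicate nl B)
     r
     (removeAll D Δ ++ replicate nl A ++ replicate nr B)
  where D = A ⇒ B
        nl = count D Γ
        nr = count D Δ

ovLL : Fm → Fm → Hyp
ovLL A B = (A ≼ B) ∷ (B ≼ A) ∷ (B ≪ A) ∷ []

ovLe : Fm → Fm → Hyp
ovLe A B = (B ≺ A) ∷ (B ≪ A) ∷ []

ovPre : Fm → Fm → Hyp
ovPre A B = (A ≪ B) ∷ (B ≺ A) ∷ (B ≪ A) ∷ []

ovStr : Fm → Fm → Hyp
ovStr A B = (A ≪ B) ∷ (B ≼ A) ∷ (B ≪ A) ∷ []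

ovSim : Fm → Fm → Hyp
ovSim A B = (A ≪ B) ∷ (B ≪ A) ∷ []

ovPre1 : Fm → Fm → Hyp
ovPre1 A B = ovSim A B ++ ovLL A top ++ ovLL B top
             ++ (sq (A ∷ B ∷ []) (str (ℤ.- (+ 1))) [] ∷ [])

ovStrM1 : Fm → Fm → Hyp
ovStrM1 A B = ovSim A B ++ ovLL A top ++ ovLL B top
              ++ (sq [] (pre (+ 1)) (A ∷ B ∷ []) ∷ [])

filterS : (Seq → Bool) → Hyp → Hyp
filterS p [] = []
filterS p (s ∷ ss) = if p s then s ∷ filterS p ss else filterS p ss

pivot : Hyp → Fm
pivot G = maxOf (fmsH G)

premises : Hyp → List Hyp
premises G = go (pivot G)
  where
  go : Fm → List Hyp
  go D = rule D
    where
    H G′ G″ G‴ : Hyp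
    H   = filterS (λ s → not (has D s)) G
    G′  = filterS (λ s → has D s ∧ isLL s) G
    G″  = filterS (λ s → has D s ∧ not (isLL s)) G
    G‴  = filterS isPre0Small G″
    Cof : Fm → Fm → Fm
    Cof A B = if A <c B then A else B
    rule : Fm → List Hyp
    rule (A ⊙ B) =
      (ovLL A B ++ map (sub1 D A) G ++ H) ∷
      (ovLL B A ++ map (sub1 D B) G ++ H) ∷
      (ovPre1 A B ++ map (sub1 D (Cof A B)) G′ ++ map (sub2 D A B) G″ ++ H) ∷
      (ovStrM1 A B ++ map (sub1 D (Cof A B)) G′ ++ map (subOdotShift A B) G″ ++ H) ∷
      (ovPre top A ++ ovPre top B ++ map (sub1 D top) G′ ++ map (sub1 D top) G‴ ++ H) ∷
      []
    rule (A ⇒ B) =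
      (ovLL B A ++ map (sub1 D B) G ++ H) ∷
      (ovStr B A ++ map (sub1 D (Cof A B)) G′ ++ map (subImp A B) G″ ++ H) ∷
      (ovLe A B ++ map (sub1 D top) G′ ++ map (sub1 D top) G‴ ++ H) ∷
      []
    rule _ = []

-- The RWBL reduction tree T_A, described by its nodes:
-- Node A d G : there is a node of T_A at depth d labelled G.

rootLabel : Fm → Hyp
rootLabel A = (top ≼ A) ∷ []

data Node (A : Fm) : ℕ → Hyp → Set where
  root  : Node A 0 (rootLabel A)
  child : ∀ {d G G′} → Node A d G → T (not (irreducible G)) →
          G′ ∈ premises G → Node A (suc d) G′

Leaf : Fm → ℕ → Hyp → Set
Leaf A d G = Node A d G × T (irreducible G)

{-# OPTIONS --safe #-}
-- Every formula of a premise is ⊤, an operand of the pivot, or a formula of the conclusion other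
-- than the pivot. Since the pivot has maximal complexity in the conclusion, it is then not a
-- compound subformula of any formula of the premise. So starting from the c(A) compound
-- subformula occurrences of A and deleting one copy of the pivot at every rewriting step, we keep
-- a list of length c(A) − d containing every compound subformula of the label at depth d.
module Submission where

open import Defs
open import Data.Nat using (ℕ; _≤_)
open import Data.Product using (_×_)
open import Relation.Binary.PropositionalEquality using (_≡_)

open import Data.Bool using (true; false; not; _∧_; if_then_else_; T)
open import Data.Bool.Properties using (not-injective)
open import Data.Empty using (⊥-elim)
open import Data.List using (List; []; _∷_; _++_; map; concatMap; length; replicate)
open import Data.List.Properties using (length-++; length-++-sucʳ; concatMap-++)
open import Data.List.Membership.Propositional using (_∈_; find; lose)
open import Data.List.Membership.Propositional.Properties
  using (∈-++⁺ˡ; ∈-++⁺ʳ; ∈-++⁻; ∈-map⁻; ∈-concatMap⁺; ∈-concatMap⁻; ∈-∃++)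
open import Data.List.Relation.Binary.Subset.Propositional using (_⊆_)
open import Data.List.Relation.Binary.Subset.Propositional.Properties using (⊆-refl; ⊆-trans)
open import Data.List.Relation.Unary.All as All using (All; []; _∷_)
open import Data.List.Relation.Unary.All.Properties using (++⁺; replicate⁺)
open import Data.List.Relation.Unary.Any using (here; there)
open import Data.Nat using (zero; suc; _+_; _<_; _<ᵇ_; _≡ᵇ_; s≤s)
open import Data.Nat.Properties
open import Data.Product as Prod using (∃; _,_; proj₁; proj₂; uncurry)
open import Data.Sum as Sum using (_⊎_; inj₁; inj₂; [_,_]′)
open import Function using (_∘_)
open import Relation.Binary.PropositionalEquality
  using (refl; sym; trans; cong; cong₂; subst; _≢_; module ≡-Reasoning)

∈-if : ∀ {A : Set} {x y : A} {xs} b → x ∈ xs → y ∈ xs → (if b then x else y) ∈ xs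
∈-if true x∈ _ = x∈
∈-if false _ y∈ = y∈

∈⇒removal : ∀ {A : Set} {x : A} {xs} → x ∈ xs →
            ∃ λ ys → suc (length ys) ≡ length xs × (∀ {y} → y ∈ xs → y ≢ x → y ∈ ys)
∈⇒removal {x = x} x∈xs with ys , zs , refl ← ∈-∃++ x∈xs =
  ys ++ zs , sym (length-++-sucʳ ys x zs) , keep
  where
  keep : ∀ {y} → y ∈ ys ++ x ∷ zs → y ≢ x → y ∈ ys ++ zs
  keep y∈ y≢x with ∈-++⁻ ys y∈
  ... | inj₁ p = ∈-++⁺ˡ p
  ... | inj₂ (here refl) = ⊥-elim (y≢x refl)
  ... | inj₂ (there p) = ∈-++⁺ʳ ys p

cmpℕ-refl : ∀ n → cmpℕ n n ≡ EQ
cmpℕ-refl zero = refl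
cmpℕ-refl (suc n) = cmpℕ-refl n

cmpFm-refl : ∀ F → cmpFm F F ≡ EQ
cmpFm-refl bot = refl
cmpFm-refl top = refl
cmpFm-refl (var i) = cmpℕ-refl i
cmpFm-refl (A ⊙ B) rewrite cmpFm-refl A | cmpFm-refl B = refl
cmpFm-refl (A ⇒ B) rewrite cmpFm-refl A | cmpFm-refl B = refl

eqF-refl : ∀ F → eqF F F ≡ true
eqF-refl F rewrite cmpFm-refl F = refl

eqF≡false⇒≢ : ∀ {D F} → eqF D F ≡ false → F ≢ D
eqF≡false⇒≢ {D} e refl with () ← trans (sym (eqF-refl D)) e

<c⇒c≤ : ∀ {A B} → (A <c B) ≡ true → c A ≤ c B
<c⇒c≤ {A} {B} e with c A <ᵇ c B in lt | c A ≡ᵇ c B in eq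
... | true  | _    = <⇒≤ (<ᵇ⇒< (c A) (c B) (subst T (sym lt) _))
... | false | true = ≤-reflexive (≡ᵇ⇒≡ (c A) (c B) (subst T (sym eq) _))

≮c⇒c≥ : ∀ {A B} → (A <c B) ≡ false → c B ≤ c A
≮c⇒c≥ {A} {B} e with c A <ᵇ c B in lt
... | false = ≮⇒≥ (λ c<c → subst T lt (<⇒<ᵇ c<c))

c≤c-larger : ∀ A B → c A ≤ c (if A <c B then B else A) × c B ≤ c (if A <c B then B else A)
c≤c-larger A B with A <c B in e
... | true  = <c⇒c≤ e , ≤-refl
... | false = ≤-refl , ≮c⇒c≥ e

maxFrom-∈ : ∀ m Fs → maxFrom m Fs ∈ m ∷ Fs
maxFrom-∈ m [] = here refl
maxFrom-∈ m (F ∷ Fs) with m <c F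
... | true = there (maxFrom-∈ F Fs)
... | false with maxFrom-∈ m Fs
...   | here e = here e
...   | there p = there (there p)

c≤maxFrom : ∀ m Fs {F} → F ∈ m ∷ Fs → c F ≤ c (maxFrom m Fs)
c≤maxFrom m [] (here refl) = ≤-refl
c≤maxFrom m (F ∷ Fs) (here refl) = ≤-trans (proj₁ (c≤c-larger m F)) (c≤maxFrom _ Fs (here refl))
c≤maxFrom m (F ∷ Fs) (there (here refl)) = ≤-trans (proj₂ (c≤c-larger m F)) (c≤maxFrom _ Fs (here refl))
c≤maxFrom m (F ∷ Fs) (there (there p)) = c≤maxFrom _ Fs (there p)

maxOf-∈ : ∀ Fs → T (not (atomic (maxOf Fs))) → maxOf Fs ∈ Fs
maxOf-∈ (F ∷ Fs) _ = maxFrom-∈ F Fs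

c≤maxOf : ∀ Fs {F} → F ∈ Fs → c F ≤ c (maxOf Fs)
c≤maxOf (F ∷ Fs) = c≤maxFrom F Fs

compounds : Fm → List Fm
compounds (A ⊙ B) = (A ⊙ B) ∷ compounds A ++ compounds B
compounds (A ⇒ B) = (A ⇒ B) ∷ compounds A ++ compounds B
compounds _ = []

length-compounds : ∀ F → length (compounds F) ≡ c F
length-compounds bot = refl
length-compounds top = refl
length-compounds (var _) = refl
length-compounds (A ⊙ B) =
  cong suc (trans (length-++ (compounds A)) (cong₂ _+_ (length-compounds A) (length-compounds B)))
length-compounds (A ⇒ B) =
  cong suc (trans (length-++ (compounds A)) (cong₂ _+_ (length-compounds A) (length-compounds B)))

∈-compounds-self : ∀ {F} → T (not (atomic F)) → F ∈ compounds F
∈-compounds-self {_ ⊙ _} _ = here refl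
∈-compounds-self {_ ⇒ _} _ = here refl

mutual
  ∈-compounds⇒≡⊎< : ∀ {S} F → S ∈ compounds F → S ≡ F ⊎ c S < c F
  ∈-compounds⇒≡⊎< (A ⊙ B) (here refl) = inj₁ refl
  ∈-compounds⇒≡⊎< (A ⊙ B) (there p) = inj₂ (∈-proper-compounds⇒< A B p)
  ∈-compounds⇒≡⊎< (A ⇒ B) (here refl) = inj₁ refl
  ∈-compounds⇒≡⊎< (A ⇒ B) (there p) = inj₂ (∈-proper-compounds⇒< A B p)

  ∈-compounds⇒≤ : ∀ {S} F → S ∈ compounds F → c S ≤ c F
  ∈-compounds⇒≤ F p with ∈-compounds⇒≡⊎< F p
  ... | inj₁ refl = ≤-refl
  ... | inj₂ lt = <⇒≤ lt

  ∈-proper-compounds⇒< : ∀ {S} A B → S ∈ compounds A ++ compounds B → c S < suc (c A + c B)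
  ∈-proper-compounds⇒< A B p with ∈-++⁻ (compounds A) p
  ... | inj₁ q = s≤s (≤-trans (∈-compounds⇒≤ A q) (m≤m+n (c A) (c B)))
  ... | inj₂ q = s≤s (≤-trans (∈-compounds⇒≤ B q) (m≤n+m (c B) (c A)))

∈-compounds⇒≢ : ∀ {S F D} → S ∈ compounds F → F ≢ D → c F ≤ c D → S ≢ D
∈-compounds⇒≢ {F = F} p F≢D cF≤cD refl with ∈-compounds⇒≡⊎< F p
... | inj₁ refl = F≢D refl
... | inj₂ lt = <-irrefl refl (<-≤-trans lt cF≤cD)

operands : Fm → List Fm
operands (A ⊙ B) = A ∷ B ∷ []
operands (A ⇒ B) = A ∷ B ∷ []
operands _ = []

operand-c< : ∀ {F D} → F ∈ operands D → c F < c D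
operand-c< {D = A ⊙ B} (here refl) = s≤s (m≤m+n (c A) (c B))
operand-c< {D = A ⊙ B} (there (here refl)) = s≤s (m≤n+m (c B) (c A))
operand-c< {D = A ⇒ B} (here refl) = s≤s (m≤m+n (c A) (c B))
operand-c< {D = A ⇒ B} (there (here refl)) = s≤s (m≤n+m (c B) (c A))

operand-compounds : ∀ {F D} → F ∈ operands D → compounds F ⊆ compounds D
operand-compounds {D = A ⊙ B} (here refl) = there ∘ ∈-++⁺ˡ
operand-compounds {D = A ⊙ B} (there (here refl)) = there ∘ ∈-++⁺ʳ (compounds A)
operand-compounds {D = A ⇒ B} (here refl) = there ∘ ∈-++⁺ˡ
operand-compounds {D = A ⇒ B} (there (here refl)) = there ∘ ∈-++⁺ʳ (compounds A)

Drawn : Fm → List Fm → List Fm → Fm → Set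
Drawn D Ns xs F = F ∈ Ns ⊎ (F ∈ xs × eqF D F ≡ false)

drawn-++ : ∀ D {Ns Γ Δ Γ′ Δ′ F} →
           (F ∈ Γ′ → Drawn D Ns Γ F) → (F ∈ Δ′ → Drawn D Ns Δ F) →
           F ∈ Γ′ ++ Δ′ → Drawn D Ns (Γ ++ Δ) F
drawn-++ D {Γ = Γ} {Γ′ = Γ′} left right p with ∈-++⁻ Γ′ p
... | inj₁ q = Sum.map₂ (Prod.map₁ ∈-++⁺ˡ) (left q)
... | inj₂ q = Sum.map₂ (Prod.map₁ (∈-++⁺ʳ Γ)) (right q)

∈-map-if⁻ : ∀ D {E F} xs → F ∈ map (λ F₀ → if eqF D F₀ then E else F₀) xs → Drawn D (E ∷ []) xs F
∈-map-if⁻ D (x ∷ xs) p with eqF D x in e | p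
... | true  | here refl = inj₁ (here refl)
... | false | here refl = inj₂ (here refl , e)
... | _     | there q = Sum.map₂ (Prod.map₁ there) (∈-map-if⁻ D xs q)

∈-concatMap-if⁻ : ∀ D {E E′ F} xs →
                  F ∈ concatMap (λ F₀ → if eqF D F₀ then E ∷ E′ ∷ [] else F₀ ∷ []) xs →
                  Drawn D (E ∷ E′ ∷ []) xs F
∈-concatMap-if⁻ D (x ∷ xs) p with eqF D x in e | p
... | true  | here refl = inj₁ (here refl)
... | true  | there (here refl) = inj₁ (there (here refl))
... | true  | there (there q) = Sum.map₂ (Prod.map₁ there) (∈-concatMap-if⁻ D xs q)
... | false | here refl = inj₂ (here refl , e)
... | false | there q = Sum.map₂ (Prod.map₁ there) (∈-concatMap-if⁻ D xs q)

∈-removeAll-++⁻ : ∀ D {Ns ys F} xs → All (_∈ Ns) ys → F ∈ removeAll D xs ++ ys → Drawn D Ns xs F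
∈-removeAll-++⁻ D [] new p = inj₁ (All.lookup new p)
∈-removeAll-++⁻ D (x ∷ xs) new p with eqF D x in e | p
... | true  | q = Sum.map₂ (Prod.map₁ there) (∈-removeAll-++⁻ D xs new q)
... | false | here refl = inj₂ (here refl , e)
... | false | there q = Sum.map₂ (Prod.map₁ there) (∈-removeAll-++⁻ D xs new q)

Rewrites : Fm → List Fm → (Seq → Seq) → Set
Rewrites D Ns φ = ∀ s {F} → F ∈ fmsS (φ s) → Drawn D Ns (fmsS s) F

sub1-rewrites : ∀ D E → Rewrites D (E ∷ []) (sub1 D E)
sub1-rewrites D E (sq Γ r Δ) = drawn-++ D (∈-map-if⁻ D Γ) (∈-map-if⁻ D Δ)

sub2-rewrites : ∀ D E E′ → Rewrites D (E ∷ E′ ∷ []) (sub2 D E E′)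
sub2-rewrites D E E′ (sq Γ r Δ) = drawn-++ D (∈-concatMap-if⁻ D Γ) (∈-concatMap-if⁻ D Δ)

subOdotShift-rewrites : ∀ A B → Rewrites (A ⊙ B) (A ∷ B ∷ []) (subOdotShift A B)
subOdotShift-rewrites A B (sq Γ r Δ) =
  drawn-++ (A ⊙ B) (∈-removeAll-++⁻ (A ⊙ B) Γ both) (∈-removeAll-++⁻ (A ⊙ B) Δ both)
  where both : All (_∈ A ∷ B ∷ []) (A ∷ B ∷ [])
        both = here refl ∷ there (here refl) ∷ []

subImp-rewrites : ∀ A B → Rewrites (A ⇒ B) (A ∷ B ∷ []) (subImp A B)
subImp-rewrites A B (sq Γ r Δ) =
  drawn-++ (A ⇒ B) (∈-removeAll-++⁻ (A ⇒ B) Γ (copies nΔ nΓ)) (∈-removeAll-++⁻ (A ⇒ B) Δ (copies nΓ nΔ))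
  where nΓ nΔ : ℕ
        nΓ = count (A ⇒ B) Γ
        nΔ = count (A ⇒ B) Δ
        copies : ∀ m n → All (_∈ A ∷ B ∷ []) (replicate m A ++ replicate n B)
        copies m n = ++⁺ (replicate⁺ m (here refl)) (replicate⁺ n (there (here refl)))

∈-fmsH⁻ : ∀ {G F} → F ∈ fmsH G → ∃ λ s → s ∈ G × F ∈ fmsS s
∈-fmsH⁻ = find ∘ ∈-concatMap⁻ fmsS

∈-fmsH⁺ : ∀ {G s F} → s ∈ G → F ∈ fmsS s → F ∈ fmsH G
∈-fmsH⁺ s∈G F∈s = ∈-concatMap⁺ fmsS (lose s∈G F∈s)

∈-filterS⁻ : ∀ p G {s} → s ∈ filterS p G → s ∈ G × p s ≡ true
∈-filterS⁻ p (x ∷ G) m with p x in e | m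
... | true  | here refl = here refl , e
... | true  | there m′ = Prod.map₁ there (∈-filterS⁻ p G m′)
... | false | m′ = Prod.map₁ there (∈-filterS⁻ p G m′)

filterS-⊆ : ∀ p G → filterS p G ⊆ G
filterS-⊆ p G = proj₁ ∘ ∈-filterS⁻ p G

anyEq≡false⁻ : ∀ D Fs {F} → anyEq D Fs ≡ false → F ∈ Fs → eqF D F ≡ false
anyEq≡false⁻ D (x ∷ Fs) none m with eqF D x in e | m
... | false | here refl = e
... | false | there m′ = anyEq≡false⁻ D Fs none m′

News : Fm → List Fm
News D = top ∷ operands D

module Premise (G : Hyp) where

  H G′ G″ G‴ : Fm → Hyp
  H  D = filterS (λ s → not (has D s)) G
  G′ D = filterS (λ s → has D s ∧ isLL s) G
  G″ D = filterS (λ s → has D s ∧ not (isLL s)) G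
  G‴ D = filterS isPre0Small (G″ D)

  record Covered (D : Fm) (P : Hyp) : Set where
    constructor covered
    field inherited : ∀ {F} → F ∈ fmsH P → Drawn D (News D) (fmsH G) F

  infixr 5 _⊕_
  _⊕_ : ∀ {D P Q} → Covered D P → Covered D Q → Covered D (P ++ Q)
  _⊕_ {P = P} {Q} (covered p) (covered q) =
    covered λ {F} F∈ → [ p , q ]′ (∈-++⁻ (fmsH P) (subst (F ∈_) (concatMap-++ fmsS P Q) F∈))

  new-covered : ∀ {D} P → All (_∈ News D) (fmsH P) → Covered D P
  new-covered P new = covered (inj₁ ∘ All.lookup new)

  map-covered : ∀ {D Ns φ} P → All (_∈ News D) Ns → Rewrites D Ns φ → P ⊆ G → Covered D (map φ P)
  map-covered {φ = φ} P new rewrites P⊆G = covered λ F∈ →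
    let s′ , s′∈ , F∈s′ = ∈-fmsH⁻ F∈
        s , s∈P , s′≡φs = ∈-map⁻ φ s′∈
    in Sum.map (All.lookup new) (Prod.map₁ (∈-fmsH⁺ (P⊆G s∈P)))
               (rewrites s (subst (λ t → _ ∈ fmsS t) s′≡φs F∈s′))

  H-covered : ∀ {D} → Covered D (H D)
  H-covered {D} = covered λ F∈ →
    let s , s∈H , F∈s = ∈-fmsH⁻ F∈
        s∈G , untouched = ∈-filterS⁻ _ G s∈H
    in inj₂ (∈-fmsH⁺ s∈G F∈s , anyEq≡false⁻ D (fmsS s) (not-injective untouched) F∈s)

  G′-⊆ : ∀ D → G′ D ⊆ G
  G′-⊆ D = filterS-⊆ _ G

  G″-⊆ : ∀ D → G″ D ⊆ G
  G″-⊆ D = filterS-⊆ _ G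

  G‴-⊆ : ∀ D → G‴ D ⊆ G
  G‴-⊆ D = ⊆-trans (filterS-⊆ isPre0Small (G″ D)) (G″-⊆ D)

  AbbreviationCovered : (Fm → Fm → Hyp) → Set
  AbbreviationCovered ov = ∀ {D U V} → U ∈ News D → V ∈ News D → Covered D (ov U V)

  ovLL-covered : AbbreviationCovered ovLL
  ovLL-covered {U = U} {V} u v = new-covered (ovLL U V) (u ∷ v ∷ v ∷ u ∷ v ∷ u ∷ [])

  ovLe-covered : AbbreviationCovered ovLe
  ovLe-covered {U = U} {V} u v = new-covered (ovLe U V) (v ∷ u ∷ v ∷ u ∷ [])

  ovPre-covered : AbbreviationCovered ovPre
  ovPre-covered {U = U} {V} u v = new-covered (ovPre U V) (u ∷ v ∷ v ∷ u ∷ v ∷ u ∷ [])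

  ovStr-covered : AbbreviationCovered ovStr
  ovStr-covered {U = U} {V} u v = new-covered (ovStr U V) (u ∷ v ∷ v ∷ u ∷ v ∷ u ∷ [])

  ovSim-covered : AbbreviationCovered ovSim
  ovSim-covered {U = U} {V} u v = new-covered (ovSim U V) (u ∷ v ∷ v ∷ u ∷ [])

  ovPre1-covered : AbbreviationCovered ovPre1
  ovPre1-covered u v =
    ovSim-covered u v ⊕ ovLL-covered u (here refl) ⊕ ovLL-covered v (here refl) ⊕ new-covered _ (u ∷ v ∷ [])

  ovStrM1-covered : AbbreviationCovered ovStrM1
  ovStrM1-covered u v =
    ovSim-covered u v ⊕ ovLL-covered u (here refl) ⊕ ovLL-covered v (here refl) ⊕ new-covered _ (u ∷ v ∷ [])

  pattern ⊤∈ = here refl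
  pattern A∈ = there (here refl)
  pattern B∈ = there (there (here refl))

  premise-covered : ∀ {P} → P ∈ premises G → Covered (pivot G) P
  premise-covered p with pivot G | p
  ... | A ⊙ B | here refl =
    ovLL-covered A∈ B∈ ⊕ map-covered G (A∈ ∷ []) (sub1-rewrites (A ⊙ B) A) ⊆-refl ⊕ H-covered
  ... | A ⊙ B | there (here refl) =
    ovLL-covered B∈ A∈ ⊕ map-covered G (B∈ ∷ []) (sub1-rewrites (A ⊙ B) B) ⊆-refl ⊕ H-covered
  ... | A ⊙ B | there (there (here refl)) =
    ovPre1-covered A∈ B∈
    ⊕ map-covered (G′ (A ⊙ B)) (∈-if (A <c B) A∈ B∈ ∷ []) (sub1-rewrites (A ⊙ B) _) (G′-⊆ _)
    ⊕ map-covered (G″ (A ⊙ B)) (A∈ ∷ B∈ ∷ []) (sub2-rewrites (A ⊙ B) A B) (G″-⊆ _)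
    ⊕ H-covered
  ... | A ⊙ B | there (there (there (here refl))) =
    ovStrM1-covered A∈ B∈
    ⊕ map-covered (G′ (A ⊙ B)) (∈-if (A <c B) A∈ B∈ ∷ []) (sub1-rewrites (A ⊙ B) _) (G′-⊆ _)
    ⊕ map-covered (G″ (A ⊙ B)) (A∈ ∷ B∈ ∷ []) (subOdotShift-rewrites A B) (G″-⊆ _)
    ⊕ H-covered
  ... | A ⊙ B | there (there (there (there (here refl)))) =
    ovPre-covered ⊤∈ A∈ ⊕ ovPre-covered ⊤∈ B∈
    ⊕ map-covered (G′ (A ⊙ B)) (⊤∈ ∷ []) (sub1-rewrites (A ⊙ B) top) (G′-⊆ _)
    ⊕ map-covered (G‴ (A ⊙ B)) (⊤∈ ∷ []) (sub1-rewrites (A ⊙ B) top) (G‴-⊆ _)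
    ⊕ H-covered
  ... | A ⇒ B | here refl =
    ovLL-covered B∈ A∈ ⊕ map-covered G (B∈ ∷ []) (sub1-rewrites (A ⇒ B) B) ⊆-refl ⊕ H-covered
  ... | A ⇒ B | there (here refl) =
    ovStr-covered B∈ A∈
    ⊕ map-covered (G′ (A ⇒ B)) (∈-if (A <c B) A∈ B∈ ∷ []) (sub1-rewrites (A ⇒ B) _) (G′-⊆ _)
    ⊕ map-covered (G″ (A ⇒ B)) (A∈ ∷ B∈ ∷ []) (subImp-rewrites A B) (G″-⊆ _)
    ⊕ H-covered
  ... | A ⇒ B | there (there (here refl)) =
    ovLe-covered A∈ B∈
    ⊕ map-covered (G′ (A ⇒ B)) (⊤∈ ∷ []) (sub1-rewrites (A ⇒ B) top) (G′-⊆ _)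
    ⊕ map-covered (G‴ (A ⇒ B)) (⊤∈ ∷ []) (sub1-rewrites (A ⇒ B) top) (G‴-⊆ _)
    ⊕ H-covered

pivot-compound : ∀ G {P} → P ∈ premises G → T (not (atomic (pivot G)))
pivot-compound G p with pivot G | p
... | _ ⊙ _ | _ = _
... | _ ⇒ _ | _ = _

CompoundsIn : Hyp → List Fm → Set
CompoundsIn G L = ∀ {F} → F ∈ fmsH G → compounds F ⊆ L

pivot-∈ : ∀ G {P} → P ∈ premises G → pivot G ∈ fmsH G
pivot-∈ G p = maxOf-∈ (fmsH G) (pivot-compound G p)

premise-formulas : ∀ G {P F} → P ∈ premises G → F ∈ fmsH P → Drawn (pivot G) (News (pivot G)) (fmsH G) F
premise-formulas G p = Premise.Covered.inherited (Premise.premise-covered G p)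

drawn-compounds : ∀ G {L F} → CompoundsIn G L → pivot G ∈ fmsH G →
                  Drawn (pivot G) (News (pivot G)) (fmsH G) F →
                  ∀ {S} → S ∈ compounds F → S ∈ L × S ≢ pivot G
drawn-compounds G inL D∈G (inj₁ (here refl)) ()
drawn-compounds G inL D∈G (inj₁ (there o)) S∈ =
  inL D∈G (operand-compounds o S∈) ,
  ∈-compounds⇒≢ S∈ (λ F≡D → <-irrefl (cong c F≡D) (operand-c< o)) (<⇒≤ (operand-c< o))
drawn-compounds G inL D∈G (inj₂ (F∈G , F≢D)) S∈ =
  inL F∈G S∈ , ∈-compounds⇒≢ S∈ (eqF≡false⇒≢ F≢D) (c≤maxOf (fmsH G) F∈G)

premise-shrinks : ∀ {G L P} → CompoundsIn G L → P ∈ premises G →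
                  ∃ λ L′ → CompoundsIn P L′ × suc (length L′) ≡ length L
premise-shrinks {G} inL p
  with L′ , shrink , keep ← ∈⇒removal (inL (pivot-∈ G p) (∈-compounds-self (pivot-compound G p))) =
  L′ , (λ F∈P → uncurry keep ∘ drawn-compounds G inL (pivot-∈ G p) (premise-formulas G p F∈P)) , shrink

node-compounds : ∀ {A d G} → Node A d G → ∃ λ L → CompoundsIn G L × d + length L ≡ c A
node-compounds {A} root = compounds A , inL , length-compounds A
  where
  inL : CompoundsIn (rootLabel A) (compounds A)
  inL (here refl) = λ ()
  inL (there (here refl)) = ⊆-refl
node-compounds {A} {suc d} (child node _ p) =
  let L , inL , d+L≡cA = node-compounds node
      L′ , inL′ , shrink = premise-shrinks inL p
  in L′ , inL′ , (begin
       suc d + length L′   ≡⟨ sym (+-suc d (length L′)) ⟩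
       d + suc (length L′) ≡⟨ cong (d +_) shrink ⟩
       d + length L        ≡⟨ d+L≡cA ⟩
       c A                 ∎)
  where open ≡-Reasoning

depth≤c : ∀ {A d G} → Node A d G → d ≤ c A
depth≤c {d = d} node =
  let L , _ , d+L≡cA = node-compounds node
  in subst (d ≤_) d+L≡cA (m≤m+n d (length L))

lemma5p1 : (A : Fm) (n : ℕ) → NoTop A → c A ≡ n →
    (∀ {d G} → Leaf A d G → d ≤ n) × (∀ {d G} → Node A d G → d ≤ n)
lemma5p1 A n _ refl = depth≤c ∘ proj₁ , depth≤c
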